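{- Let $T$ be a basic tournament, $\hat T$ a transitive blowup of $T$, $u\notin V(\hat T)$, and $\sigma$ a dominating relation between $u$ and $V(\hat T)$ such that $u$ is a non-CR vertex for $\hat T$ with $\sigma$. Then $\hat T(u,\sigma)$ is not switching equivalent to a transitive blowup of $T$.
   Context: A tournament is a digraph with exactly one arc between each pair of distinct vertices. For distinct vertices write $\theta_R(u,v)=1$ if $u\to v$, $-1$ otherwise. Transitive blowup of $T$ with vertices $v_1,\dots,v_n$: for positive integers $a_i$, replace each $v_i$ by a transitive tournament $H_i$ on $a_i$ vertices, with all arcs from $V(H_i)$ to $V(H_j)$ whenever $v_i\to v_j$. The switch of $R$ w.r.t. $W\subseteq V(R)$ reverses all arcs between $W$ and $V(R)\setminus W$; "$R$ is switching equivalent to a transitive blowup of $T$" means some switch of $R$ is (isomorphic to) a transitive blowup of $T$. Two vertices $u_1,u_2$ of $R$ are covertices and revertices if $|V(R)|=2$; if $|V(R)|\ge3$ they are covertices if $\theta_R(u_1,v)=\theta_R(u_2,v)$ for all other $v$, revertices if $\theta_R(u_1,v)=-\theta_R(u_2,v)$ for all other $v$; CR-associated if either. A tournament of order at least 4 is basic if no two of its vertices are CR-associated. For $u\notin V(R)=\{w_1,\dots,w_m\}$ and $\sigma=(r_1,\dots,r_m)\in\{\pm1\}^m$, $R(u,\sigma)$ extends $R$ by $u$ with $u\to w_i$ iff $r_i=1$; $u$ is a non-CR vertex for $R$ with $\sigma$ if no vertex of $R$ is CR-associated with $u$ in $R(u,\sigma)$. -}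

module Defs where

open import Data.Nat using (ℕ; suc; _≤_)
open import Data.Fin using (Fin; zero; suc)
open import Data.Bool using (Bool; true; false; not; if_then_else_; _xor_)
open import Data.Product using (Σ; ∃; _×_)
open import Data.Sum using (_⊎_)
open import Relation.Binary.PropositionalEquality using (_≡_; _≢_)
open import Relation.Nullary using (¬_)

-- A digraph on vertex set Fin n, given by its arc indicator:
-- R u v ≡ true  means  u → v.  For distinct u v, θ_R(u,v) = 1 iff R u v ≡ true
-- (θ ∈ {±1} is encoded by Bool: true ↔ 1, false ↔ -1).
-- The diagonal R u u is irrelevant and never used.
Digraph : ℕ → Set
Digraph n = Fin n → Fin n → Bool

IsTournament : ∀ {n} → Digraph n → Set
IsTournament {n} R = ∀ (u v : Fin n) → u ≢ v → R v u ≡ not (R u v)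

Covertices : ∀ {n} → Digraph n → Fin n → Fin n → Set
Covertices {n} R u₁ u₂ =
  (n ≡ 2) ⊎ ((3 ≤ n) × (∀ v → v ≢ u₁ → v ≢ u₂ → R u₁ v ≡ R u₂ v))

Revertices : ∀ {n} → Digraph n → Fin n → Fin n → Set
Revertices {n} R u₁ u₂ =
  (n ≡ 2) ⊎ ((3 ≤ n) × (∀ v → v ≢ u₁ → v ≢ u₂ → R u₁ v ≡ not (R u₂ v)))

CRAssociated : ∀ {n} → Digraph n → Fin n → Fin n → Set
CRAssociated R u₁ u₂ = Covertices R u₁ u₂ ⊎ Revertices R u₁ u₂

IsBasic : ∀ {n} → Digraph n → Set
IsBasic {n} T = IsTournament T × (4 ≤ n) ×
  (∀ (u₁ u₂ : Fin n) → u₁ ≢ u₂ → ¬ CRAssociated T u₁ u₂)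

IsTransitiveBlowup : ∀ {m n} → Digraph m → Digraph n → Set
IsTransitiveBlowup {m} {n} R T =
  IsTournament R ×
  Σ (Fin m → Fin n) λ f →
    (∀ (i : Fin n) → ∃ λ x → f x ≡ i) ×
    (∀ (x y : Fin m) → f x ≢ f y → R x y ≡ T (f x) (f y)) ×
    (∀ (x y z : Fin m) → f x ≡ f y → f y ≡ f z →
       x ≢ y → y ≢ z → x ≢ z →
       R x y ≡ true → R y z ≡ true → R x z ≡ true)

switch : ∀ {n} → Digraph n → (Fin n → Bool) → Digraph n
switch R W x y = if W x xor W y then not (R x y) else R x y

SwitchingEquivToTransitiveBlowup : ∀ {m n} → Digraph m → Digraph n → Set
SwitchingEquivToTransitiveBlowup {m} R T =
  ∃ λ (W : Fin m → Bool) → IsTransitiveBlowup (switch R W) T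

-- R(u, σ): extend R (on Fin m) by a new vertex u, represented as vertex zero
-- of Fin (suc m); old vertex w_i becomes suc i.  u → w_i iff σ i ≡ true.
extend : ∀ {m} → Digraph m → (Fin m → Bool) → Digraph (suc m)
extend R σ zero    zero    = false
extend R σ zero    (suc j) = σ j
extend R σ (suc i) zero    = not (σ i)
extend R σ (suc i) (suc j) = R i j

IsNonCR : ∀ {m} → Digraph m → (Fin m → Bool) → Set
IsNonCR {m} R σ = ∀ (w : Fin m) → ¬ CRAssociated (extend R σ) zero (suc w)

{-# OPTIONS --safe #-}
module Submission where

open import Defs
open import Data.Nat using (ℕ)
open import Data.Fin using (Fin)
open import Data.Bool using (Bool)
open import Relation.Nullary using (¬_)

open import Level using (0ℓ)
open import Data.Nat using (zero; suc; _≤_)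
open import Data.Nat.Properties using (≤-trans; n≤1+n; m≤n⇒m≤1+n; 1+n≰n)
open import Data.Fin using (zero; suc; punchOut)
open import Data.Fin.Properties using (_≟_; suc-injective; punchOut-injective; injective⇒≤)
open import Data.Bool using (true; false; not; _xor_)
import Data.Bool.Properties as Bool
open import Data.Bool.Solver using (module xor-∧-Solver)
open import Data.Product using (∃; ∃₂; _×_; _,_; proj₁; proj₂)
open import Data.Sum using (_⊎_; inj₁; inj₂; [_,_]′; swap)
open import Data.Empty using (⊥)
open import Function using (_∘_; flip; id)
open import Function.Definitions using (Injective)
open import Relation.Nullary using (Dec; yes; no; contradiction)
open import Relation.Nullary.Decidable using (¬?; _×-dec_; decidable-stable)
open import Relation.Unary using (Pred; Decidable)
open import Relation.Binary using (Rel)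
open import Relation.Binary.PropositionalEquality
  using (_≡_; _≢_; refl; sym; trans; cong; ≢-sym; module ≡-Reasoning)

open ≡-Reasoning

-- Suppose some switch B of T̂(u,σ) is a transitive blowup of T, with fibre map g.
-- Two vertices that are consecutive in the linear order of a g-fibre are
-- covertices of B, and switching turns covertices into CR-associated vertices.
-- So a property that is not constant on a g-fibre separates a CR-associated
-- pair of T̂(u,σ).  Applied to "being u" this shows that u is alone in its
-- g-fibre, since u is non-CR.  Applied to the fibres of the blowup map f of T̂,
-- it shows that each g-fibre of an old vertex lies inside one f-fibre: a CR pair
-- of T̂ in two different f-fibres would be a CR pair of the basic tournament T.
-- Hence an old vertex over each of the n vertices of T gives n distinct
-- g-images, all different from g(u): T would need n + 1 vertices.

record Associated {n} (R : Digraph n) (s : Bool) (p q : Fin n) : Set where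
  field
    agree : ∀ v → v ≢ p → v ≢ q → R p v ≡ s xor R q v

open Associated

associated⇒CRAssociated : ∀ {n} {R : Digraph n} {s p q} →
  3 ≤ n → Associated R s p q → CRAssociated R p q
associated⇒CRAssociated {s = false} 3≤n assoc = inj₁ (inj₂ (3≤n , agree assoc))
associated⇒CRAssociated {s = true}  3≤n assoc = inj₂ (inj₂ (3≤n , agree assoc))

covertices-sym : ∀ {n} {R : Digraph n} {p q} → Associated R false p q → Associated R false q p
agree (covertices-sym assoc) v v≢q v≢p = sym (agree assoc v v≢p v≢q)

extend-associated : ∀ {m} {R : Digraph m} {σ s p q} →
  Associated (extend R σ) s (suc p) (suc q) → Associated R s p q
agree (extend-associated assoc) v v≢p v≢q = agree assoc (suc v) (v≢p ∘ suc-injective) (v≢q ∘ suc-injective)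

switch-xor : ∀ {n} (R : Digraph n) W x y → switch R W x y ≡ (W x xor W y) xor R x y
switch-xor R W x y with W x xor W y
... | true  = refl
... | false = refl

switch-associated : ∀ {n} (R : Digraph n) W {s p q} →
  Associated (switch R W) s p q → Associated R (s xor (W p xor W q)) p q
agree (switch-associated R W {s} {p} {q} assoc) v v≢p v≢q = begin
  R p v                                    ≡⟨ solve 2 (λ a r → r := a :+ (a :+ r)) refl (W p xor W v) (R p v) ⟩
  (W p xor W v) xor ((W p xor W v) xor R p v) ≡⟨ cong ((W p xor W v) xor_) (sym (switch-xor R W p v)) ⟩
  (W p xor W v) xor switch R W p v         ≡⟨ cong ((W p xor W v) xor_) (agree assoc v v≢p v≢q) ⟩
  (W p xor W v) xor (s xor switch R W q v) ≡⟨ cong (λ t → (W p xor W v) xor (s xor t)) (switch-xor R W q v) ⟩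
  (W p xor W v) xor (s xor ((W q xor W v) xor R q v))
    ≡⟨ solve 5 (λ x y w s t → (x :+ w) :+ (s :+ ((y :+ w) :+ t)) := (s :+ (x :+ y)) :+ t)
             refl (W p) (W q) (W v) s (R q v) ⟩
  (s xor (W p xor W q)) xor R q v          ∎
  where open xor-∧-Solver

Least : ∀ {k} → Rel (Fin k) 0ℓ → Pred (Fin k) 0ℓ → Pred (Fin k) 0ℓ
Least _<_ P z = P z × (∀ w → P w → w ≢ z → z < w)

least-or-empty : ∀ {k} {_<_ : Rel (Fin k) 0ℓ} {P : Pred (Fin k) 0ℓ} → Decidable P →
  (∀ {p q} → P p → P q → p ≢ q → p < q ⊎ q < p) →
  (∀ {p q r} → P p → P q → P r → p < q → q < r → p < r) →
  (∀ w → ¬ P w) ⊎ ∃ (Least _<_ P)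
least-or-empty {zero} _ _ _ = inj₁ λ ()
least-or-empty {suc k} {_<_} {P} P? connex trans<
  with least-or-empty {k} {λ a b → suc a < suc b} {P ∘ suc} (P? ∘ suc)
       (λ pp pq p≢q → connex pp pq (p≢q ∘ suc-injective)) trans< | P? zero
... | inj₁ none | no ¬p₀ = inj₁ λ { zero → ¬p₀ ; (suc w) → none w }
... | inj₁ none | yes p₀ =
  inj₂ (zero , p₀ , λ { zero _ 0≢0 → contradiction refl 0≢0 ; (suc w) pw _ → contradiction pw (none w) })
... | inj₂ (z , pz , z-least) | no ¬p₀ =
  inj₂ (suc z , pz , λ { zero p₀ _ → contradiction p₀ ¬p₀ ; (suc w) pw w≢z → z-least w pw (w≢z ∘ cong suc) })
... | inj₂ (z , pz , z-least) | yes p₀ with connex p₀ pz (λ ())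
...   | inj₂ z<0 = inj₂ (suc z , pz , λ { zero _ _ → z<0 ; (suc w) pw w≢z → z-least w pw (w≢z ∘ cong suc) })
...   | inj₁ 0<z = inj₂ (zero , p₀ , λ { zero _ 0≢0 → contradiction refl 0≢0 ; (suc w) pw _ → 0<suc w pw })
  where
  0<suc : ∀ w → P (suc w) → zero < suc w
  0<suc w pw with w ≟ z
  ... | yes refl = 0<z
  ... | no w≢z   = trans< p₀ pz pw 0<z (z-least w pw w≢z)

least : ∀ {k} {_<_ : Rel (Fin k) 0ℓ} {P : Pred (Fin k) 0ℓ} → Decidable P →
  (∀ {p q} → P p → P q → p ≢ q → p < q ⊎ q < p) →
  (∀ {p q r} → P p → P q → P r → p < q → q < r → p < r) →
  ∃ P → ∃ (Least _<_ P)
least P? connex trans< (a , pa) = [ (λ none → contradiction pa (none a)) , id ]′ (least-or-empty P? connex trans<)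

no-injection-avoiding : ∀ {n} (c : Fin n) {h : Fin n → Fin n} → (∀ j → h j ≢ c) → ¬ Injective _≡_ _≡_ h
no-injection-avoiding {suc n} c {h} avoids h-injective = 1+n≰n (injective⇒≤ {f = punched} punched-injective)
  where
  punched : Fin (suc n) → Fin n
  punched j = punchOut (avoids j ∘ sym)

  punched-injective : Injective _≡_ _≡_ punched
  punched-injective eq = h-injective (punchOut-injective (avoids _ ∘ sym) (avoids _ ∘ sym) eq)

module Blowup {k n} {R : Digraph k} {T : Digraph n} (blowup : IsTransitiveBlowup R T) where

  tournament : IsTournament R
  tournament = proj₁ blowup

  π : Fin k → Fin n
  π = proj₁ (proj₂ blowup)

  π-surjective : ∀ i → ∃ λ x → π x ≡ i
  π-surjective = proj₁ (proj₂ (proj₂ blowup))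

  arc-across : ∀ x y → π x ≢ π y → R x y ≡ T (π x) (π y)
  arc-across = proj₁ (proj₂ (proj₂ (proj₂ blowup)))

  fibre-transitive : ∀ x y z → π x ≡ π y → π y ≡ π z → x ≢ y → y ≢ z → x ≢ z →
    R x y ≡ true → R y z ≡ true → R x z ≡ true
  fibre-transitive = proj₂ (proj₂ (proj₂ (proj₂ blowup)))

  section : Fin n → Fin k
  section i = proj₁ (π-surjective i)

  π∘section-injective : Injective _≡_ _≡_ (π ∘ section)
  π∘section-injective {i} {j} eq = trans (sym (proj₂ (π-surjective i))) (trans eq (proj₂ (π-surjective j)))

  n≤k : n ≤ k
  n≤k = injective⇒≤ {f = section} (π∘section-injective ∘ cong π)

  associated-across : ∀ {s x z} → Associated R s x z → Associated T s (π x) (π z)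
  agree (associated-across {s} {x} {z} assoc) i i≢πx i≢πz with π-surjective i
  ... | v , refl = begin
    T (π x) (π v)        ≡⟨ sym (arc-across x v (≢-sym i≢πx)) ⟩
    R x v                ≡⟨ agree assoc v (i≢πx ∘ cong π) (i≢πz ∘ cong π) ⟩
    s xor R z v          ≡⟨ cong (s xor_) (arc-across z v (≢-sym i≢πz)) ⟩
    s xor T (π z) (π v)  ∎

  _≺_ : Rel (Fin k) 0ℓ
  x ≺ y = x ≢ y × R x y ≡ true

  ≺? : ∀ x y → Dec (x ≺ y)
  ≺? x y = ¬? (x ≟ y) ×-dec (R x y Bool.≟ true)

  ≺-flip : ∀ {x y} → x ≢ y → R x y ≡ false → y ≺ x
  ≺-flip {x} {y} x≢y xy = ≢-sym x≢y , trans (tournament x y x≢y) (cong not xy)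

  ≺-connex : ∀ {x y} → x ≢ y → x ≺ y ⊎ y ≺ x
  ≺-connex {x} {y} x≢y with R x y in xy
  ... | true  = inj₁ (x≢y , refl)
  ... | false = inj₂ (≺-flip x≢y xy)

  ≺-asym : ∀ {x y} → x ≺ y → ¬ y ≺ x
  ≺-asym {x} {y} (x≢y , xy) (_ , yx) with trans (sym yx) (trans (tournament x y x≢y) (cong not xy))
  ... | ()

  ≺-trans : ∀ {x y z} → π x ≡ π y → π y ≡ π z → x ≺ y → y ≺ z → x ≺ z
  ≺-trans {x} {y} {z} πx≡πy πy≡πz x≺y@(x≢y , xy) y≺z@(y≢z , yz) =
    x≢z , fibre-transitive x y z πx≡πy πy≡πz x≢y y≢z x≢z xy yz
    where
    x≢z : x ≢ z
    x≢z refl = ≺-asym x≺y y≺z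

  adjacent⇒covertices : ∀ {x z} → π x ≡ π z → x ≺ z →
    (∀ v → π v ≡ π x → ¬ (x ≺ v × v ≺ z)) → Associated R false x z
  agree (adjacent⇒covertices {x} {z} πx≡πz x≺z nothing-between) v v≢x v≢z with π v ≟ π x
  ... | no πv≢πx = begin
    R x v          ≡⟨ arc-across x v (≢-sym πv≢πx) ⟩
    T (π x) (π v)  ≡⟨ cong (λ i → T i (π v)) πx≡πz ⟩
    T (π z) (π v)  ≡⟨ sym (arc-across z v (λ πz≡πv → πv≢πx (trans (sym πz≡πv) (sym πx≡πz)))) ⟩
    R z v          ∎
  ... | yes πv≡πx with R x v in xv | R z v in zv
  ...   | true  | true  = refl
  ...   | false | false = refl
  ...   | true  | false =
    contradiction ((≢-sym v≢x , xv) , ≺-flip (≢-sym v≢z) zv) (nothing-between v πv≡πx)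
  ...   | false | true  =
    contradiction (≺-trans (trans (sym πx≡πz) (sym πv≡πx)) πv≡πx (≢-sym v≢z , zv) (≺-flip (≢-sym v≢x) xv))
                  (≺-asym x≺z)

  module _ {c : Fin n} {P : Pred (Fin k) 0ℓ} (P? : Decidable P) (in-fibre : ∀ {w} → P w → π w ≡ c) where

    private
      same-fibre : ∀ {v w} → P v → P w → π v ≡ π w
      same-fibre pv pw = trans (in-fibre pv) (sym (in-fibre pw))

    ≺-minimum : ∃ P → ∃ (Least _≺_ P)
    ≺-minimum = least P? (λ _ _ → ≺-connex)
      (λ pp pq pr → ≺-trans (same-fibre pp pq) (same-fibre pq pr))

    ≺-maximum : ∃ P → ∃ (Least (flip _≺_) P)
    ≺-maximum = least P? (λ _ _ → swap ∘ ≺-connex)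
      (λ pp pq pr q≺p r≺q → ≺-trans (same-fibre pr pq) (same-fibre pq pp) r≺q q≺p)

  SeparatedCovertexPair : Pred (Fin k) 0ℓ → Fin k → Set
  SeparatedCovertexPair Φ a = ∃₂ λ x z → π x ≡ π a × π z ≡ π a × Φ x × ¬ Φ z × Associated R false x z

  -- x is the last Φ-vertex before z, the first ¬Φ-vertex after a.
  ordered-separated⇒covertices : ∀ {Φ : Pred (Fin k) 0ℓ} → Decidable Φ → ∀ {a b} →
    π a ≡ π b → a ≺ b → Φ a → ¬ Φ b → SeparatedCovertexPair Φ a
  ordered-separated⇒covertices {Φ} Φ? {a} {b} πa≡πb a≺b Φa ¬Φb =
    from-first (≺-minimum Later? proj₁ (b , sym πa≡πb , ¬Φb , a≺b))
    where
    Later : Pred (Fin k) 0ℓ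
    Later w = π w ≡ π a × ¬ Φ w × a ≺ w

    Later? : Decidable Later
    Later? w = (π w ≟ π a) ×-dec (¬? (Φ? w) ×-dec ≺? a w)

    Before : Fin k → Pred (Fin k) 0ℓ
    Before z w = π w ≡ π a × Φ w × w ≺ z

    Before? : ∀ z → Decidable (Before z)
    Before? z w = (π w ≟ π a) ×-dec (Φ? w ×-dec ≺? w z)

    from-first : ∃ (Least _≺_ Later) → SeparatedCovertexPair Φ a
    from-first (z , (πz , ¬Φz , a≺z) , z-first) =
      from-last (≺-maximum (Before? z) proj₁ (a , refl , Φa , a≺z))
      where
      from-last : ∃ (Least (flip _≺_) (Before z)) → SeparatedCovertexPair Φ a
      from-last (x , (πx , Φx , x≺z) , x-last) =
        x , z , πx , πz , Φx , ¬Φz , adjacent⇒covertices (trans πx (sym πz)) x≺z nothing-between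
        where
        nothing-between : ∀ v → π v ≡ π x → ¬ (x ≺ v × v ≺ z)
        nothing-between v πv≡πx (x≺v , v≺z) with Φ? v
        ... | yes Φv = ≺-asym x≺v (x-last v (trans πv≡πx πx , Φv , v≺z) (≢-sym (proj₁ x≺v)))
        ... | no ¬Φv = ≺-asym v≺z (z-first v (trans πv≡πx πx , ¬Φv , a≺v) (proj₁ v≺z))
          where
          a≺v : a ≺ v
          a≺v with a ≟ x
          ... | yes refl = x≺v
          ... | no a≢x   = ≺-trans (sym πx) (sym πv≡πx) (x-last a (refl , Φa , a≺z) a≢x) x≺v

  separated⇒covertices : ∀ {Φ : Pred (Fin k) 0ℓ} → Decidable Φ → ∀ {a b} →
    π a ≡ π b → Φ a → ¬ Φ b → SeparatedCovertexPair Φ a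
  separated⇒covertices Φ? {a} {b} πa≡πb Φa ¬Φb with ≺-connex {a} {b} (λ { refl → ¬Φb Φa })
  ... | inj₁ a≺b = ordered-separated⇒covertices Φ? πa≡πb a≺b Φa ¬Φb
  ... | inj₂ b≺a with ordered-separated⇒covertices (¬? ∘ Φ?) (sym πa≡πb) b≺a ¬Φb (λ ¬Φa → ¬Φa Φa)
  ...   | x , z , πx , πz , ¬Φx , ¬¬Φz , cov =
    z , x , trans πz (sym πa≡πb) , trans πx (sym πa≡πb) , decidable-stable (Φ? z) ¬¬Φz , ¬Φx , covertices-sym cov

module _ {n m} {T : Digraph n} {T̂ : Digraph m} {σ : Fin m → Bool} {W : Fin (suc m) → Bool}
  (basic : IsBasic T) (T̂-blowup : IsTransitiveBlowup T̂ T) (nonCR : IsNonCR T̂ σ)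
  (switched-blowup : IsTransitiveBlowup (switch (extend T̂ σ) W) T) where

  private
    module F = Blowup {T = T} T̂-blowup
    module G = Blowup {T = T} switched-blowup

    B : Digraph (suc m)
    B = switch (extend T̂ σ) W

    3≤n : 3 ≤ n
    3≤n = ≤-trans (n≤1+n 3) (proj₁ (proj₂ basic))

    3≤1+m : 3 ≤ suc m
    3≤1+m = m≤n⇒m≤1+n (≤-trans 3≤n F.n≤k)

  new-vertex-has-no-covertex : ∀ w → ¬ Associated B false zero (suc w)
  new-vertex-has-no-covertex w =
    nonCR w ∘ associated⇒CRAssociated 3≤1+m ∘ switch-associated (extend T̂ σ) W

  no-old-covertices-across-fibres : ∀ {x z} → F.π x ≢ F.π z → ¬ Associated B false (suc x) (suc z)
  no-old-covertices-across-fibres πx≢πz =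
    proj₂ (proj₂ basic) _ _ πx≢πz ∘ associated⇒CRAssociated 3≤n ∘ F.associated-across
      ∘ extend-associated ∘ switch-associated (extend T̂ σ) W

  new-vertex-alone : ∀ w → G.π (suc w) ≢ G.π zero
  new-vertex-alone w same with G.separated⇒covertices (_≟ zero) (sym same) refl (λ ())
  ... | .zero , zero   , _ , _ , refl , z≢0 , _   = z≢0 refl
  ... | .zero , suc w′ , _ , _ , refl , _   , cov = new-vertex-has-no-covertex w′ cov

  Over : Fin n → Pred (Fin (suc m)) 0ℓ
  Over i zero    = ⊥
  Over i (suc v) = F.π v ≡ i

  Over? : ∀ i → Decidable (Over i)
  Over? i zero    = no id
  Over? i (suc v) = F.π v ≟ i

  G-fibres-refine-F-fibres : ∀ {a b} → G.π (suc a) ≡ G.π (suc b) → F.π a ≡ F.π b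
  G-fibres-refine-F-fibres {a} {b} same with F.π a ≟ F.π b
  ... | yes πa≡πb = πa≡πb
  ... | no πa≢πb with G.separated⇒covertices (Over? (F.π a)) same refl (πa≢πb ∘ sym)
  ...   | zero   , _      , _ , _  , ()
  ...   | suc _  , zero   , _ , πz , _   , _   , _   = contradiction (sym πz) (new-vertex-alone a)
  ...   | suc x′ , suc z′ , _ , _  , x′-over , z′-not-over , cov =
    contradiction cov (no-old-covertices-across-fibres (λ πx′≡πz′ → z′-not-over (trans (sym πx′≡πz′) x′-over)))

  switched-blowup⇒⊥ : ⊥
  switched-blowup⇒⊥ = no-injection-avoiding (G.π zero) {G.π ∘ suc ∘ F.section}
    (new-vertex-alone ∘ F.section) (F.π∘section-injective ∘ G-fibres-refine-F-fibres)

proposition4p9 : ∀ {n m : ℕ} (T : Digraph n) (T̂ : Digraph m) (σ : Fin m → Bool) →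
    IsBasic T → IsTransitiveBlowup T̂ T → IsNonCR T̂ σ →
    ¬ SwitchingEquivToTransitiveBlowup (extend T̂ σ) T
proposition4p9 T T̂ σ basic T̂-blowup nonCR (W , switched-blowup) =
  switched-blowup⇒⊥ {W = W} basic T̂-blowup nonCR switched-blowup
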